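{- Let $X_1\to X_2\to\cdots\to X_n$ be a Markov chain of $\{0,1\}$-valued random variables (a Bayesian network on a directed line). Then for any $i<j<k$, $\mathrm{Br}(X_i\mid X_k)\ge\mathrm{Br}(X_i\mid X_j)$.
   Context: For binary $X,Y$, the conditional Bernoulli randomness is $\mathrm{Br}(X\mid Y)=\sum_{y\in\{0,1\}}2\min\big(\Pr(X=0,Y=y),\Pr(X=1,Y=y)\big)$.
   Formalization: The initial distribution and the transition probabilities of the Markov chain take rational values. -}

module Defs where

open import Data.Bool using (Bool; true; false; if_then_else_)
open import Data.Nat using (ℕ; zero; suc)
open import Data.Fin using (Fin)
open import Data.Vec using (Vec; []; _∷_; lookup)
open import Data.Rational using (ℚ; 0ℚ; 1ℚ; _+_; _*_; _⊓_; _≤_)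
open import Relation.Binary.PropositionalEquality using (_≡_)

_==ᵇ_ : Bool → Bool → Bool
true  ==ᵇ true  = true
false ==ᵇ false = true
_     ==ᵇ _     = false

-- sum of f over all 2^n configurations in {0,1}^n (false = 0, true = 1)
sumAll : (n : ℕ) → (Vec Bool n → ℚ) → ℚ
sumAll zero    f = f []
sumAll (suc n) f = sumAll n (λ xs → f (false ∷ xs)) + sumAll n (λ xs → f (true ∷ xs))

-- A Markov chain X₁ → X₂ → ⋯ → Xₙ on {0,1} (Bayesian network on a directed
-- line): an initial distribution π and transition kernels K t (from X_t to
-- X_{t+1}, indexed from 0).
record MarkovChain : Set where
  field
    π     : Bool → ℚ
    K     : ℕ → Bool → Bool → ℚ
    π-nonneg : ∀ a → 0ℚ ≤ π a
    π-sum    : π false + π true ≡ 1ℚ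
    K-nonneg : ∀ t a b → 0ℚ ≤ K t a b
    K-sum    : ∀ t a → K t a false + K t a true ≡ 1ℚ

open MarkovChain public

chainWeight : MarkovChain → ℕ → {n : ℕ} → Bool → Vec Bool n → ℚ
chainWeight M t prev []       = 1ℚ
chainWeight M t prev (y ∷ ys) = K M t prev y * chainWeight M (suc t) y ys

jointProb : MarkovChain → {n : ℕ} → Vec Bool n → ℚ
jointProb M []       = 1ℚ
jointProb M (x ∷ xs) = π M x * chainWeight M 0 x xs

prob2 : MarkovChain → (n : ℕ) → Fin n → Bool → Fin n → Bool → ℚ
prob2 M n i a j b =
  sumAll n (λ x → if (lookup x i ==ᵇ a) then (if (lookup x j ==ᵇ b) then jointProb M x else 0ℚ) else 0ℚ)

two : ℚ
two = 1ℚ + 1ℚ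

Br : MarkovChain → (n : ℕ) → Fin n → Fin n → ℚ
Br M n i j =
    two * (prob2 M n i false j false ⊓ prob2 M n i true j false)
  + two * (prob2 M n i false j true  ⊓ prob2 M n i true j true)

{-# OPTIONS --safe #-}
-- Conditioning on X_j, the Markov property factorises the joint table of
-- (X_i, X_k) as P(X_i = a, X_k = c) = Σ_b P(X_i = a, X_j = b) Q(b, c), where Q
-- is the stochastic kernel from X_j to X_k (Chapman–Kolmogorov).  Br cannot
-- decrease under such a post-composition: with m_b = min_a P(a, b), every
-- entry of column c of P Q is at least Σ_b m_b Q(b, c), and summing over c
-- gives back Σ_b m_b because the rows of Q sum to 1.
module Submission where

open import Defs
open import Data.Bool using (Bool; true; false; if_then_else_)
open import Data.Fin using (Fin; zero; suc; _<_)
open import Data.Nat using (ℕ; zero; suc; s≤s)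
open import Data.Product using (∃-syntax; _×_; _,_)
open import Data.Rational using (ℚ; 0ℚ; 1ℚ; _+_; _*_; _⊓_; _≤_; nonNegative)
import Data.Rational.Properties as ℚ
open import Data.Rational.Solver using (module +-*-Solver)
open import Data.Vec using (Vec; []; _∷_; head; tail; lookup)
open import Relation.Binary.PropositionalEquality
open +-*-Solver

nonNeg-+ : ∀ {p q} → 0ℚ ≤ p → 0ℚ ≤ q → 0ℚ ≤ p + q
nonNeg-+ = ℚ.+-mono-≤

nonNeg-* : ∀ {p q} → 0ℚ ≤ p → 0ℚ ≤ q → 0ℚ ≤ p * q
nonNeg-* {p} {q} 0≤p 0≤q =
  ℚ.nonNegative⁻¹ (p * q) {{ℚ.nonNeg*nonNeg⇒nonNeg p {{nonNegative 0≤p}} q {{nonNegative 0≤q}}}}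

*-monoʳ-≤-nonNeg : ∀ {r p q} → 0ℚ ≤ r → p ≤ q → p * r ≤ q * r
*-monoʳ-≤-nonNeg {r} 0≤r = ℚ.*-monoʳ-≤-nonNeg r {{nonNegative 0≤r}}

*-monoˡ-≤-nonNeg : ∀ {r p q} → 0ℚ ≤ r → p ≤ q → r * p ≤ r * q
*-monoˡ-≤-nonNeg {r} 0≤r = ℚ.*-monoˡ-≤-nonNeg r {{nonNegative 0≤r}}

sumAll-cong : ∀ n {f g : Vec Bool n → ℚ} → (∀ x → f x ≡ g x) → sumAll n f ≡ sumAll n g
sumAll-cong zero    f≗g = f≗g []
sumAll-cong (suc n) f≗g =
  cong₂ _+_ (sumAll-cong n (λ xs → f≗g (false ∷ xs))) (sumAll-cong n (λ xs → f≗g (true ∷ xs)))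

sumAll-+ : ∀ n (f g : Vec Bool n → ℚ) → sumAll n (λ x → f x + g x) ≡ sumAll n f + sumAll n g
sumAll-+ zero    f g = refl
sumAll-+ (suc n) f g = begin
  sumAll n (λ xs → f (false ∷ xs) + g (false ∷ xs)) + sumAll n (λ xs → f (true ∷ xs) + g (true ∷ xs))
    ≡⟨ cong₂ _+_ (sumAll-+ n _ _) (sumAll-+ n _ _) ⟩
  (F₀ + G₀) + (F₁ + G₁)
    ≡⟨ solve 4 (λ a b c d → (a :+ b) :+ (c :+ d) := (a :+ c) :+ (b :+ d)) refl F₀ G₀ F₁ G₁ ⟩
  (F₀ + F₁) + (G₀ + G₁) ∎
  where
  open ≡-Reasoning
  F₀ = sumAll n (λ xs → f (false ∷ xs))
  F₁ = sumAll n (λ xs → f (true ∷ xs))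
  G₀ = sumAll n (λ xs → g (false ∷ xs))
  G₁ = sumAll n (λ xs → g (true ∷ xs))

sumAll-*ˡ : ∀ n c (f : Vec Bool n → ℚ) → sumAll n (λ x → c * f x) ≡ c * sumAll n f
sumAll-*ˡ zero    c f = refl
sumAll-*ˡ (suc n) c f =
  trans (cong₂ _+_ (sumAll-*ˡ n c _) (sumAll-*ˡ n c _)) (sym (ℚ.*-distribˡ-+ c _ _))

sumAll-zero : ∀ n → sumAll n (λ _ → 0ℚ) ≡ 0ℚ
sumAll-zero zero    = refl
sumAll-zero (suc n) = cong₂ _+_ (sumAll-zero n) (sumAll-zero n)

sumAll-nonNeg : ∀ n {f : Vec Bool n → ℚ} → (∀ x → 0ℚ ≤ f x) → 0ℚ ≤ sumAll n f
sumAll-nonNeg zero    0≤f = 0≤f []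
sumAll-nonNeg (suc n) 0≤f =
  nonNeg-+ (sumAll-nonNeg n (λ xs → 0≤f (false ∷ xs))) (sumAll-nonNeg n (λ xs → 0≤f (true ∷ xs)))

if-*ˡ : ∀ u c w → (if u then c * w else 0ℚ) ≡ c * (if u then w else 0ℚ)
if-*ˡ true  c w = refl
if-*ˡ false c w = sym (ℚ.*-zeroʳ c)

if-+ : ∀ u v w → (if u then v else 0ℚ) + (if u then w else 0ℚ) ≡ (if u then v + w else 0ℚ)
if-+ true  v w = refl
if-+ false v w = refl

if-nonNeg : ∀ u {w} → 0ℚ ≤ w → 0ℚ ≤ (if u then w else 0ℚ)
if-nonNeg true  0≤w = 0≤w
if-nonNeg false 0≤w = ℚ.≤-refl

if-==ᵇ-split : ∀ b w → (if b ==ᵇ false then w else 0ℚ) + (if b ==ᵇ true then w else 0ℚ) ≡ w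
if-==ᵇ-split false w = ℚ.+-identityʳ w
if-==ᵇ-split true  w = ℚ.+-identityˡ w

sumAll-if-*ˡ : ∀ n (u : Vec Bool n → Bool) c (f : Vec Bool n → ℚ) →
  sumAll n (λ x → if u x then c * f x else 0ℚ) ≡ c * sumAll n (λ x → if u x then f x else 0ℚ)
sumAll-if-*ˡ n u c f = trans (sumAll-cong n (λ x → if-*ˡ (u x) c (f x))) (sumAll-*ˡ n c _)

sumAll-if-head : ∀ n b (g : Bool → Vec Bool n → ℚ) →
  sumAll (suc n) (λ x → if head x ==ᵇ b then g (head x) (tail x) else 0ℚ) ≡ sumAll n (g b)
sumAll-if-head n false g = trans (cong (sumAll n (g false) +_) (sumAll-zero n)) (ℚ.+-identityʳ _)
sumAll-if-head n true  g = trans (cong (_+ sumAll n (g true)) (sumAll-zero n)) (ℚ.+-identityˡ _)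

Matrix : Set
Matrix = Bool → Bool → ℚ

record IsStochastic (Q : Matrix) : Set where
  field
    nonNeg : ∀ b c → 0ℚ ≤ Q b c
    rowSum : ∀ b → Q b false + Q b true ≡ 1ℚ

_▷_ : (Bool → ℚ) → Matrix → Bool → ℚ
(v ▷ Q) c = v false * Q false c + v true * Q true c

_⊙_ : Matrix → Matrix → Matrix
(P ⊙ Q) a = P a ▷ Q

_≐_ : Matrix → Matrix → Set
P ≐ Q = ∀ a c → P a c ≡ Q a c

infixl 7 _▷_ _⊙_
infix 4 _≐_

▷-total : ∀ v {Q} → IsStochastic Q → (v ▷ Q) false + (v ▷ Q) true ≡ v false + v true
▷-total v {Q} Q-stoch = begin
  (v₀ * Q false false + v₁ * Q true false) + (v₀ * Q false true + v₁ * Q true true)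
    ≡⟨ solve 6 (λ v₀ v₁ a b c d → (v₀ :* a :+ v₁ :* c) :+ (v₀ :* b :+ v₁ :* d)
                                  := v₀ :* (a :+ b) :+ v₁ :* (c :+ d))
         refl v₀ v₁ (Q false false) (Q false true) (Q true false) (Q true true) ⟩
  v₀ * (Q false false + Q false true) + v₁ * (Q true false + Q true true)
    ≡⟨ cong₂ (λ x y → v₀ * x + v₁ * y) (rowSum false) (rowSum true) ⟩
  v₀ * 1ℚ + v₁ * 1ℚ
    ≡⟨ cong₂ _+_ (ℚ.*-identityʳ v₀) (ℚ.*-identityʳ v₁) ⟩
  v₀ + v₁ ∎
  where
  open ≡-Reasoning
  open IsStochastic Q-stoch
  v₀ = v false
  v₁ = v true

▷-nonNeg : ∀ {v Q} → (∀ b → 0ℚ ≤ v b) → (∀ b c → 0ℚ ≤ Q b c) → ∀ c → 0ℚ ≤ (v ▷ Q) c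
▷-nonNeg 0≤v 0≤Q c = nonNeg-+ (nonNeg-* (0≤v false) (0≤Q false c)) (nonNeg-* (0≤v true) (0≤Q true c))

▷-mono-≤ : ∀ {u v Q} → (∀ b → u b ≤ v b) → (∀ b c → 0ℚ ≤ Q b c) → ∀ c → (u ▷ Q) c ≤ (v ▷ Q) c
▷-mono-≤ u≤v 0≤Q c =
  ℚ.+-mono-≤ (*-monoʳ-≤-nonNeg (0≤Q false c) (u≤v false)) (*-monoʳ-≤-nonNeg (0≤Q true c) (u≤v true))

⊙-assoc : ∀ P Q R → (P ⊙ Q) ⊙ R ≐ P ⊙ (Q ⊙ R)
⊙-assoc P Q R a c =
  solve 8 (λ p₀ p₁ q₀₀ q₀₁ q₁₀ q₁₁ r₀ r₁ →
              (p₀ :* q₀₀ :+ p₁ :* q₁₀) :* r₀ :+ (p₀ :* q₀₁ :+ p₁ :* q₁₁) :* r₁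
           := p₀ :* (q₀₀ :* r₀ :+ q₀₁ :* r₁) :+ p₁ :* (q₁₀ :* r₀ :+ q₁₁ :* r₁))
    refl (P a false) (P a true) (Q false false) (Q false true) (Q true false) (Q true true)
    (R false c) (R true c)

⊙-congˡ : ∀ {P P′} Q → P ≐ P′ → P ⊙ Q ≐ P′ ⊙ Q
⊙-congˡ Q P≐P′ a c = cong₂ (λ x y → x * Q false c + y * Q true c) (P≐P′ a false) (P≐P′ a true)

⊙-congʳ : ∀ P {Q Q′} → Q ≐ Q′ → P ⊙ Q ≐ P ⊙ Q′
⊙-congʳ P Q≐Q′ a c = cong₂ (λ x y → P a false * x + P a true * y) (Q≐Q′ false c) (Q≐Q′ true c)

*-⊙ : ∀ (w : Bool → ℚ) P Q a c → w a * (P ⊙ Q) a c ≡ ((λ a b → w a * P a b) ⊙ Q) a c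
*-⊙ w P Q a c =
  solve 5 (λ w p₀ p₁ q₀ q₁ → w :* (p₀ :* q₀ :+ p₁ :* q₁) := w :* p₀ :* q₀ :+ w :* p₁ :* q₁)
    refl (w a) (P a false) (P a true) (Q false c) (Q true c)

K-stochastic : ∀ M t → IsStochastic (K M t)
K-stochastic M t = record { nonNeg = K-nonneg M t ; rowSum = K-sum M t }

chainWeight-nonNeg : ∀ M t p {n} (xs : Vec Bool n) → 0ℚ ≤ chainWeight M t p xs
chainWeight-nonNeg M t p []       = ℚ.nonNegative⁻¹ 1ℚ
chainWeight-nonNeg M t p (y ∷ ys) = nonNeg-* (K-nonneg M t p y) (chainWeight-nonNeg M (suc t) y ys)

chainWeight-sum : ∀ M t p n → sumAll n (chainWeight M t p) ≡ 1ℚ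
chainWeight-sum M t p zero    = refl
chainWeight-sum M t p (suc n) = begin
  sumAll n (λ ys → K M t p false * chainWeight M (suc t) false ys)
    + sumAll n (λ ys → K M t p true * chainWeight M (suc t) true ys)
    ≡⟨ cong₂ _+_ (sumAll-*ˡ n (K M t p false) _) (sumAll-*ˡ n (K M t p true) _) ⟩
  K M t p false * sumAll n (chainWeight M (suc t) false)
    + K M t p true * sumAll n (chainWeight M (suc t) true)
    ≡⟨ cong₂ (λ x y → K M t p false * x + K M t p true * y)
         (chainWeight-sum M (suc t) false n) (chainWeight-sum M (suc t) true n) ⟩
  K M t p false * 1ℚ + K M t p true * 1ℚ
    ≡⟨ cong₂ _+_ (ℚ.*-identityʳ (K M t p false)) (ℚ.*-identityʳ (K M t p true)) ⟩
  K M t p false + K M t p true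
    ≡⟨ K-sum M t p ⟩
  1ℚ ∎
  where open ≡-Reasoning

-- transition M t n k p c is the probability that the (k+1)-th state after
-- time t is c, given state p at time t; n is the length of the remaining path.
transition : MarkovChain → ℕ → (n : ℕ) → Fin n → Matrix
transition M t n k p c = sumAll n (λ xs → if lookup xs k ==ᵇ c then chainWeight M t p xs else 0ℚ)

transition-stochastic : ∀ M t n k → IsStochastic (transition M t n k)
transition-stochastic M t n k = record
  { nonNeg = λ p c → sumAll-nonNeg n (λ xs → if-nonNeg (lookup xs k ==ᵇ c) (chainWeight-nonNeg M t p xs))
  ; rowSum = λ p → trans (sym (sumAll-+ n _ _))
      (trans (sumAll-cong n (λ xs → if-==ᵇ-split (lookup xs k) (chainWeight M t p xs)))
             (chainWeight-sum M t p n))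
  }

transition-zero : ∀ M t n → transition M t (suc n) zero ≐ K M t
transition-zero M t n p b = begin
  transition M t (suc n) zero p b
    ≡⟨ sumAll-if-head n b (λ y ys → K M t p y * chainWeight M (suc t) y ys) ⟩
  sumAll n (λ ys → K M t p b * chainWeight M (suc t) b ys)
    ≡⟨ sumAll-*ˡ n (K M t p b) _ ⟩
  K M t p b * sumAll n (chainWeight M (suc t) b)
    ≡⟨ cong (K M t p b *_) (chainWeight-sum M (suc t) b n) ⟩
  K M t p b * 1ℚ
    ≡⟨ ℚ.*-identityʳ (K M t p b) ⟩
  K M t p b ∎
  where open ≡-Reasoning

transition-suc : ∀ M t n k → transition M t (suc n) (suc k) ≐ K M t ⊙ transition M (suc t) n k
transition-suc M t n k p c = cong₂ _+_
  (sumAll-if-*ˡ n (λ ys → lookup ys k ==ᵇ c) (K M t p false) (chainWeight M (suc t) false))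
  (sumAll-if-*ˡ n (λ ys → lookup ys k ==ᵇ c) (K M t p true) (chainWeight M (suc t) true))

transition-factorises : ∀ M t n (j k : Fin n) → j < k →
  ∃[ Q ] IsStochastic Q × transition M t n k ≐ transition M t n j ⊙ Q
transition-factorises M t (suc n) zero (suc k) _ =
  transition M (suc t) n k , transition-stochastic M (suc t) n k ,
  λ a c → trans (transition-suc M t n k a c)
                (sym (⊙-congˡ (transition M (suc t) n k) (transition-zero M t n) a c))
transition-factorises M t (suc n) (suc j) (suc k) (s≤s j<k)
  with transition-factorises M (suc t) n j k j<k
... | Q , Q-stochastic , k≐j⊙Q = Q , Q-stochastic , λ a c → begin
  transition M t (suc n) (suc k) a c
    ≡⟨ transition-suc M t n k a c ⟩
  (K M t ⊙ transition M (suc t) n k) a c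
    ≡⟨ ⊙-congʳ (K M t) k≐j⊙Q a c ⟩
  (K M t ⊙ (transition M (suc t) n j ⊙ Q)) a c
    ≡⟨ ⊙-assoc (K M t) (transition M (suc t) n j) Q a c ⟨
  (K M t ⊙ transition M (suc t) n j ⊙ Q) a c
    ≡⟨ ⊙-congˡ Q (transition-suc M t n j) a c ⟨
  (transition M t (suc n) (suc j) ⊙ Q) a c ∎
  where open ≡-Reasoning

shift : MarkovChain → MarkovChain
shift M = record
  { π        = π M ▷ K M 0
  ; K        = λ t → K M (suc t)
  ; π-nonneg = ▷-nonNeg (π-nonneg M) (K-nonneg M 0)
  ; π-sum    = trans (▷-total (π M) (K-stochastic M 0)) (π-sum M)
  ; K-nonneg = λ t → K-nonneg M (suc t)
  ; K-sum    = λ t → K-sum M (suc t)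
  }

chainWeight-shift : ∀ M t p {n} (xs : Vec Bool n) → chainWeight (shift M) t p xs ≡ chainWeight M (suc t) p xs
chainWeight-shift M t p []       = refl
chainWeight-shift M t p (y ∷ ys) = cong (K M (suc t) p y *_) (chainWeight-shift M (suc t) y ys)

jointProb-shift : ∀ M {n} (xs : Vec Bool n) →
  jointProb M (false ∷ xs) + jointProb M (true ∷ xs) ≡ jointProb (shift M) xs
jointProb-shift M [] =
  trans (cong₂ _+_ (ℚ.*-identityʳ (π M false)) (ℚ.*-identityʳ (π M true))) (π-sum M)
jointProb-shift M (y ∷ ys) = begin
  π M false * (K M 0 false y * w) + π M true * (K M 0 true y * w)
    ≡⟨ solve 5 (λ p₀ p₁ k₀ k₁ w → p₀ :* (k₀ :* w) :+ p₁ :* (k₁ :* w) := (p₀ :* k₀ :+ p₁ :* k₁) :* w)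
         refl (π M false) (π M true) (K M 0 false y) (K M 0 true y) w ⟩
  (π M ▷ K M 0) y * w
    ≡⟨ cong ((π M ▷ K M 0) y *_) (chainWeight-shift M 0 y ys) ⟨
  jointProb (shift M) (y ∷ ys) ∎
  where
  open ≡-Reasoning
  w = chainWeight M 1 y ys

joint : MarkovChain → (n : ℕ) → Fin n → Fin n → Matrix
joint M n i j a b = prob2 M n i a j b

joint-zero : ∀ M n k a c → joint M (suc n) zero (suc k) a c ≡ π M a * transition M 0 n k a c
joint-zero M n k a c = begin
  joint M (suc n) zero (suc k) a c
    ≡⟨ sumAll-if-head n a (λ y ys → if lookup ys k ==ᵇ c then π M y * chainWeight M 0 y ys else 0ℚ) ⟩
  sumAll n (λ ys → if lookup ys k ==ᵇ c then π M a * chainWeight M 0 a ys else 0ℚ)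
    ≡⟨ sumAll-if-*ˡ n (λ ys → lookup ys k ==ᵇ c) (π M a) (chainWeight M 0 a) ⟩
  π M a * transition M 0 n k a c ∎
  where open ≡-Reasoning

joint-shift : ∀ M n i k → joint M (suc n) (suc i) (suc k) ≐ joint (shift M) n i k
joint-shift M n i k a c =
  trans (sym (sumAll-+ n (λ xs → selected xs (jointProb M (false ∷ xs)))
                         (λ xs → selected xs (jointProb M (true ∷ xs)))))
        (sumAll-cong n λ xs → trans (selected-+ xs _ _) (cong (selected xs) (jointProb-shift M xs)))
  where
  selected : Vec Bool n → ℚ → ℚ
  selected xs w = if lookup xs i ==ᵇ a then (if lookup xs k ==ᵇ c then w else 0ℚ) else 0ℚ
  selected-+ : ∀ xs v w → selected xs v + selected xs w ≡ selected xs (v + w)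
  selected-+ xs v w = trans (if-+ (lookup xs i ==ᵇ a) _ _)
                            (cong (λ u → if lookup xs i ==ᵇ a then u else 0ℚ) (if-+ (lookup xs k ==ᵇ c) v w))

joint-factorises : ∀ M n (i j k : Fin n) → i < j → j < k →
  ∃[ Q ] IsStochastic Q × joint M n i k ≐ joint M n i j ⊙ Q
joint-factorises M (suc n) zero (suc j) (suc k) _ (s≤s j<k)
  with transition-factorises M 0 n j k j<k
... | Q , Q-stochastic , k≐j⊙Q = Q , Q-stochastic , λ a c → begin
  joint M (suc n) zero (suc k) a c
    ≡⟨ joint-zero M n k a c ⟩
  π M a * transition M 0 n k a c
    ≡⟨ cong (π M a *_) (k≐j⊙Q a c) ⟩
  π M a * (transition M 0 n j ⊙ Q) a c
    ≡⟨ *-⊙ (π M) (transition M 0 n j) Q a c ⟩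
  ((λ a b → π M a * transition M 0 n j a b) ⊙ Q) a c
    ≡⟨ ⊙-congˡ Q (joint-zero M n j) a c ⟨
  (joint M (suc n) zero (suc j) ⊙ Q) a c ∎
  where open ≡-Reasoning
joint-factorises M (suc n) (suc i) (suc j) (suc k) (s≤s i<j) (s≤s j<k)
  with joint-factorises (shift M) n i j k i<j j<k
... | Q , Q-stochastic , k≐j⊙Q = Q , Q-stochastic , λ a c → begin
  joint M (suc n) (suc i) (suc k) a c
    ≡⟨ joint-shift M n i k a c ⟩
  joint (shift M) n i k a c
    ≡⟨ k≐j⊙Q a c ⟩
  (joint (shift M) n i j ⊙ Q) a c
    ≡⟨ ⊙-congˡ Q (joint-shift M n i j) a c ⟨
  (joint M (suc n) (suc i) (suc j) ⊙ Q) a c ∎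
  where open ≡-Reasoning

columnMin : Matrix → Bool → ℚ
columnMin P c = P false c ⊓ P true c

bernoulliRandomness : Matrix → ℚ
bernoulliRandomness P = two * columnMin P false + two * columnMin P true

columnMin-⊙ : ∀ P {Q} → (∀ b c → 0ℚ ≤ Q b c) → ∀ c → (columnMin P ▷ Q) c ≤ columnMin (P ⊙ Q) c
columnMin-⊙ P 0≤Q c = ℚ.⊓-glb (▷-mono-≤ (λ b → ℚ.p⊓q≤p (P false b) (P true b)) 0≤Q c)
                              (▷-mono-≤ (λ b → ℚ.p⊓q≤q (P false b) (P true b)) 0≤Q c)

bernoulliRandomness-⊙ : ∀ P {Q R} → IsStochastic Q → R ≐ P ⊙ Q →
  bernoulliRandomness P ≤ bernoulliRandomness R
bernoulliRandomness-⊙ P {Q} {R} Q-stochastic R≐P⊙Q = begin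
  two * m false + two * m true
    ≡⟨ ℚ.*-distribˡ-+ two (m false) (m true) ⟨
  two * (m false + m true)
    ≡⟨ cong (two *_) (▷-total m Q-stochastic) ⟨
  two * ((m ▷ Q) false + (m ▷ Q) true)
    ≤⟨ *-monoˡ-≤-nonNeg (ℚ.nonNegative⁻¹ two)
         (ℚ.+-mono-≤ (columnMin-⊙ P nonNeg false) (columnMin-⊙ P nonNeg true)) ⟩
  two * (columnMin (P ⊙ Q) false + columnMin (P ⊙ Q) true)
    ≡⟨ cong (two *_) (cong₂ _+_ (minimum false) (minimum true)) ⟨
  two * (columnMin R false + columnMin R true)
    ≡⟨ ℚ.*-distribˡ-+ two (columnMin R false) (columnMin R true) ⟩
  bernoulliRandomness R ∎
  where
  open ℚ.≤-Reasoning
  open IsStochastic Q-stochastic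
  m = columnMin P
  minimum : ∀ c → columnMin R c ≡ columnMin (P ⊙ Q) c
  minimum c = cong₂ _⊓_ (R≐P⊙Q false c) (R≐P⊙Q true c)

lemma4 : (M : MarkovChain) (n : ℕ) (i j k : Fin n) →
         i < j → j < k →
         Br M n i j ≤ Br M n i k
lemma4 M n i j k i<j j<k with joint-factorises M n i j k i<j j<k
... | Q , Q-stochastic , k≐j⊙Q = bernoulliRandomness-⊙ (joint M n i j) Q-stochastic k≐j⊙Q
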